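{- For all integers $a,b\ge0$, $\binom{a}{b}=\sum_{k=0}^b\binom{a-b+k}{k}\binom{a-b+1}{a-2b+2k+1}$.
   Context: Binomial coefficients $\binom{m}{j}$ with $j<0$ or $j>m\ge0$ are zero. -}

module Defs where

open import Data.Nat using (ℕ; zero; suc)
open import Data.Nat.Combinatorics using (_C_)
open import Data.Integer using (ℤ; +_; -[1+_]; _+_; _*_; -_)
open import Data.Integer as ℤ using ()

-- Integer binomial coefficient (m choose j) for m, j ∈ ℤ:
--   j < 0                 ↦ 0
--   m = n ≥ 0, j = k ≥ 0  ↦ n C k   (which is 0 when k > n)
--   m = -(n+1), j = k ≥ 0 ↦ (-1)^k (n+k C k)   (= m(m-1)...(m-k+1)/k!)
signℤ : ℕ → ℤ
signℤ zero = + 1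
signℤ (suc k) = - signℤ k

binomℤ : ℤ → ℤ → ℤ
binomℤ m -[1+ _ ] = + 0
binomℤ (+ n) (+ k) = + (n C k)
binomℤ -[1+ n ] (+ k) = signℤ k * + ((n Data.Nat.+ k) C k)

sumTo : ℕ → (ℕ → ℤ) → ℤ
sumTo zero f = f 0
sumTo (suc b) f = sumTo b f + f (suc b)

module Submission where

-- For b ≤ a put c = a - b + 1.  Up to the symmetry
-- C(c, c - j) = C(c, j) of the second factor, the identity is the
-- coefficient of x^b in the power-series identity
--     (1 - x)^(-c) = (1 + x)^c · (1 - x²)^(-c),
-- the coefficients of (1 - x)^(-c) being the multiset numbers C(c-1+k, k).
-- We avoid power series and work with the truncated convolution
--     conv M c d = Σ_{k ≤ M} C(c-1+k, k) · C(c, d - 2k).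
-- Both factors obey a Pascal rule in c; the rule of the first factor is
-- applied through a summation by parts.  Together they give the Pascal
-- rule  conv (c+1) (1+d) = conv (c+1) d + conv c (1+d)  as long as the
-- truncation at M is invisible, and induction on c and d then evaluates
-- conv M c m = C(c-1+m, m) for m ≤ M.  For b > a both sides vanish, every
-- summand having a factor with a negative or too large lower index.

open import Defs
open import Data.Nat using (ℕ)
open import Data.Integer using (ℤ; +_; _+_; _-_; _*_)
open import Relation.Binary.PropositionalEquality using (_≡_)

open import Data.Nat as ℕ using (zero; suc; _≤_; _<_)
open import Data.Nat.Properties as ℕP using ()
open import Data.Nat.Combinatorics using (_C_; nCk≡nC[n∸k]; nCk+nC[k+1]≡[n+1]C[k+1]; k>n⇒nCk≡0)
open import Data.Integer using (-[1+_]; -_)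
open import Data.Integer.Properties as ℤP using ()
open import Data.Integer.Tactic.RingSolver using (solve-∀)
open import Data.Product using (_,_)
open import Relation.Binary.PropositionalEquality using (refl; sym; trans; cong; cong₂; module ≡-Reasoning)

sumTo-cong : ∀ M {f g : ℕ → ℤ} → (∀ k → f k ≡ g k) → sumTo M f ≡ sumTo M g
sumTo-cong zero    f≡g = f≡g 0
sumTo-cong (suc M) f≡g = cong₂ _+_ (sumTo-cong M f≡g) (f≡g (suc M))

sumTo-+ : ∀ M (f g : ℕ → ℤ) → sumTo M (λ k → f k + g k) ≡ sumTo M f + sumTo M g
sumTo-+ zero    f g = refl
sumTo-+ (suc M) f g =
  trans (cong (_+ (f (suc M) + g (suc M))) (sumTo-+ M f g))
        (interchange (sumTo M f) (sumTo M g) (f (suc M)) (g (suc M)))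
  where
  interchange : ∀ (w x y z : ℤ) → w + x + (y + z) ≡ w + y + (x + z)
  interchange = solve-∀

sumTo-*-+ : ∀ M (p u v : ℕ → ℤ) →
  sumTo M (λ k → p k * (u k + v k)) ≡ sumTo M (λ k → p k * u k) + sumTo M (λ k → p k * v k)
sumTo-*-+ M p u v =
  trans (sumTo-cong M (λ k → ℤP.*-distribˡ-+ (p k) (u k) (v k)))
        (sumTo-+ M (λ k → p k * u k) (λ k → p k * v k))

sumTo-zero : ∀ M {f : ℕ → ℤ} → (∀ k → f k ≡ + 0) → sumTo M f ≡ + 0
sumTo-zero zero    f≡0 = f≡0 0
sumTo-zero (suc M) f≡0 = cong₂ _+_ (sumTo-zero M f≡0) (f≡0 (suc M))

sumTo-first : ∀ M (f : ℕ → ℤ) → (∀ k → f (suc k) ≡ + 0) → sumTo M f ≡ f 0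
sumTo-first zero    f f₊≡0 = refl
sumTo-first (suc M) f f₊≡0 =
  trans (cong₂ _+_ (sumTo-first M f f₊≡0) (f₊≡0 M)) (ℤP.+-identityʳ (f 0))

sumTo-by-parts : ∀ M (p q X : ℕ → ℤ) → p 0 ≡ q 0 → (∀ k → p (suc k) ≡ p k + q (suc k)) →
  sumTo M (λ k → p k * X k) + p M * X (suc M)
    ≡ sumTo M (λ k → p k * X (suc k)) + sumTo M (λ k → q k * X k)
sumTo-by-parts zero p q X p₀ p₊ rewrite p₀ = swap (q 0) (X 0) (X 1)
  where
  swap : ∀ (a x y : ℤ) → a * x + a * y ≡ a * y + a * x
  swap = solve-∀
sumTo-by-parts (suc M) p q X p₀ p₊ = begin
    ΣpX + p (suc M) * X (suc M) + p (suc M) * X₂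
  ≡⟨ cong (λ r → ΣpX + r * X (suc M) + r * X₂) (p₊ M) ⟩
    ΣpX + (p M + q (suc M)) * X (suc M) + (p M + q (suc M)) * X₂
  ≡⟨ regroup ΣpX (p M) (q (suc M)) (X (suc M)) X₂ ⟩
    (ΣpX + p M * X (suc M)) + q (suc M) * X (suc M) + (p M + q (suc M)) * X₂
  ≡⟨ cong (λ r → r + q (suc M) * X (suc M) + (p M + q (suc M)) * X₂) (sumTo-by-parts M p q X p₀ p₊) ⟩
    ΣpX₊ + ΣqX + q (suc M) * X (suc M) + (p M + q (suc M)) * X₂
  ≡⟨ regroup′ ΣpX₊ ΣqX (q (suc M) * X (suc M)) ((p M + q (suc M)) * X₂) ⟩
    ΣpX₊ + (p M + q (suc M)) * X₂ + (ΣqX + q (suc M) * X (suc M))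
  ≡⟨ cong (λ r → ΣpX₊ + r * X₂ + (ΣqX + q (suc M) * X (suc M))) (sym (p₊ M)) ⟩
    ΣpX₊ + p (suc M) * X₂ + (ΣqX + q (suc M) * X (suc M))
  ∎
  where
  open ≡-Reasoning
  X₂ = X (suc (suc M))
  ΣpX = sumTo M (λ k → p k * X k)
  ΣpX₊ = sumTo M (λ k → p k * X (suc k))
  ΣqX = sumTo M (λ k → q k * X k)
  regroup : ∀ (s a b x y : ℤ) → s + (a + b) * x + (a + b) * y ≡ (s + a * x) + b * x + (a + b) * y
  regroup = solve-∀
  regroup′ : ∀ (s t u v : ℤ) → s + t + u + v ≡ s + v + (t + u)
  regroup′ = solve-∀

choose : ℕ → ℤ → ℤ
choose c = binomℤ (+ c)

choose-pascal : ∀ c j → choose (suc c) j ≡ choose c j + choose c (j - + 1)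
choose-pascal c -[1+ i ] = refl
choose-pascal c (+ zero) = refl
choose-pascal c (+ suc i) =
  cong +_ (trans (sym (nCk+nC[k+1]≡[n+1]C[k+1] c i)) (ℕP.+-comm (c C i) (c C suc i)))

data Offset : ℕ → ℕ → Set where
  at-or-above    : ∀ m r → Offset m (m ℕ.+ r)
  strictly-below : ∀ n r → Offset (suc n ℕ.+ r) n

offset : ∀ m n → Offset m n
offset zero    n       = at-or-above zero n
offset (suc m) zero    = strictly-below zero m
offset (suc m) (suc n) with offset m n
... | at-or-above .m r    = at-or-above (suc m) r
... | strictly-below .n r = strictly-below (suc n) r

choose-above : ∀ c j → c < j → choose c (+ j) ≡ + 0
choose-above c j c<j = cong +_ (k>n⇒nCk≡0 c<j)

-- Symmetry C(c, c - j) = C(c, j), valid for every j ∈ ℤ (both sides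
-- vanish unless 0 ≤ j ≤ c).
choose-sym : ∀ c j → choose c (+ c - j) ≡ choose c j
choose-sym c -[1+ i ] = choose-above c (c ℕ.+ suc i) (ℕP.m<m+n c (ℕ.s≤s ℕ.z≤n))
choose-sym c (+ i) with offset i c
... | at-or-above .i r =
  trans (cong (choose (i ℕ.+ r)) (cancel (+ i) (+ r)))
        (cong +_ (trans (cong ((i ℕ.+ r) C_) (sym (ℕP.m+n∸m≡n i r)))
                        (sym (nCk≡nC[n∸k] (ℕP.m≤m+n i r)))))
  where
  cancel : ∀ (I R : ℤ) → I + R - I ≡ R
  cancel = solve-∀
... | strictly-below .c r =
  trans (cong (choose c) (negative (+ c) (+ r)))
        (sym (choose-above c (suc c ℕ.+ r) (ℕ.s≤s (ℕP.m≤m+n c r))))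
  where
  negative : ∀ (C R : ℤ) → C - (+ 1 + C + R) ≡ - (+ 1 + R)
  negative = solve-∀

-- The multiset numbers C(c-1+k, k): coefficients of (1 - x)^(-c).

multichoose : ℕ → ℕ → ℤ
multichoose c k = + ((c ℕ.+ k ℕ.∸ 1) C k)

-- For c = 0 only the constant term survives: (1 - x)^0 = 1.
multichoose-zero : ∀ k → multichoose 0 (suc k) ≡ + 0
multichoose-zero k = cong +_ (k>n⇒nCk≡0 (ℕP.n<1+n k))

multichoose-pascal : ∀ c k → multichoose (suc c) (suc k) ≡ multichoose (suc c) k + multichoose c (suc k)
multichoose-pascal c k rewrite ℕP.+-suc c k =
  cong +_ (sym (nCk+nC[k+1]≡[n+1]C[k+1] (c ℕ.+ k) k))

twice : ℕ → ℤ
twice k = + k + + k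

conv : ℕ → ℕ → ℤ → ℤ
conv M c d = sumTo M (λ k → multichoose c k * choose c (d - twice k))

-- Pascal's rule for the convolution, provided the first term cut off by
-- the truncation vanishes.
conv-pascal : ∀ M c d → choose c (+ 1 + d - twice (suc M)) ≡ + 0 →
  conv M (suc c) (+ 1 + d) ≡ conv M (suc c) d + conv M c (+ 1 + d)
conv-pascal M c d cut-off = begin
    conv M (suc c) (+ 1 + d)
  ≡⟨ sumTo-cong M (λ k → cong (P k *_) (pascal-at-1+d k)) ⟩
    sumTo M (λ k → P k * (X k + Z k))
  ≡⟨ sumTo-*-+ M P X Z ⟩
    ΣPX + ΣPZ
  ≡⟨ cong (_+ ΣPZ) by-parts ⟩
    ΣPX₊ + ΣQX + ΣPZ
  ≡⟨ rotate ΣPX₊ ΣQX ΣPZ ⟩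
    ΣPZ + ΣPX₊ + ΣQX
  ≡⟨ cong (_+ ΣQX) (sym (sumTo-*-+ M P Z (X ∘suc))) ⟩
    sumTo M (λ k → P k * (Z k + X (suc k))) + ΣQX
  ≡⟨ cong (_+ ΣQX) (sumTo-cong M (λ k → cong (P k *_) (sym (pascal-at-d k)))) ⟩
    conv M (suc c) d + conv M c (+ 1 + d)
  ∎
  where
  open ≡-Reasoning
  P Q : ℕ → ℤ
  P = multichoose (suc c)
  Q = multichoose c
  X Z : ℕ → ℤ
  X k = choose c (+ 1 + d - twice k)
  Z k = choose c (d - twice k)
  _∘suc : (ℕ → ℤ) → ℕ → ℤ
  (f ∘suc) k = f (suc k)
  ΣPX = sumTo M (λ k → P k * X k)
  ΣPZ = sumTo M (λ k → P k * Z k)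
  ΣPX₊ = sumTo M (λ k → P k * X (suc k))
  ΣQX = sumTo M (λ k → Q k * X k)
  pascal-at-1+d : ∀ k → choose (suc c) (+ 1 + d - twice k) ≡ X k + Z k
  pascal-at-1+d k = trans (choose-pascal c (+ 1 + d - twice k)) (cong (λ j → X k + choose c j) (index d (+ k)))
    where
    index : ∀ (D K : ℤ) → + 1 + D - (K + K) - + 1 ≡ D - (K + K)
    index = solve-∀
  pascal-at-d : ∀ k → choose (suc c) (d - twice k) ≡ Z k + X (suc k)
  pascal-at-d k = trans (choose-pascal c (d - twice k)) (cong (λ j → Z k + choose c j) (index d (+ k)))
    where
    index : ∀ (D K : ℤ) → D - (K + K) - + 1 ≡ + 1 + D - ((+ 1 + K) + (+ 1 + K))
    index = solve-∀
  by-parts : ΣPX ≡ ΣPX₊ + ΣQX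
  by-parts = begin
      ΣPX                   ≡⟨ sym (ℤP.+-identityʳ ΣPX) ⟩
      ΣPX + + 0             ≡⟨ cong (λ r → ΣPX + r) (sym (trans (cong (P M *_) cut-off) (ℤP.*-zeroʳ (P M)))) ⟩
      ΣPX + P M * X (suc M) ≡⟨ sumTo-by-parts M P Q X refl (multichoose-pascal c) ⟩
      ΣPX₊ + ΣQX            ∎
  rotate : ∀ (x y z : ℤ) → x + y + z ≡ z + x + y
  rotate = solve-∀

conv-cut-off : ∀ c m M → m < M → choose c (+ 1 + + m - twice (suc M)) ≡ + 0
conv-cut-off c m M m<M with ℕP.m≤n⇒∃[o]m+o≡n m<M
... | r , refl = cong (choose c) (index (+ m) (+ r))
  where
  index : ∀ (m r : ℤ) → + 1 + m - ((+ 1 + (+ 1 + m + r)) + (+ 1 + (+ 1 + m + r)))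
                        ≡ - (+ 1 + (+ 1 + (+ 1 + (m + (r + r)))))
  index = solve-∀

conv-at-0 : ∀ M d → conv M 0 d ≡ choose 0 d
conv-at-0 M d =
  trans (sumTo-first M _ (λ k → cong (_* choose 0 (d - twice (suc k))) (multichoose-zero k)))
        (trans (ℤP.*-identityˡ _) (cong (choose 0) (ℤP.+-identityʳ d)))

-- At d = -1 every lower index d - 2k is negative.
conv-below-0 : ∀ M c → conv M c -[1+ 0 ] ≡ + 0
conv-below-0 M c = sumTo-zero M (λ k → trans (cong (λ j → multichoose c k * choose c j) (below k))
                                             (ℤP.*-zeroʳ (multichoose c k)))
  where
  below : ∀ k → -[1+ 0 ] - twice k ≡ -[1+ k ℕ.+ k ]
  below k = index (+ k)
    where
    index : ∀ (K : ℤ) → - + 1 - (K + K) ≡ - (+ 1 + (K + K))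
    index = solve-∀

conv-value : ∀ M c m → m ≤ M → conv M c (+ m) ≡ multichoose c m
conv-value M zero zero _ = conv-at-0 M (+ 0)
conv-value M zero (suc m) _ = trans (conv-at-0 M (+ suc m)) (sym (multichoose-zero m))
conv-value M (suc c) zero _ = begin
    conv M (suc c) (+ 0)
  ≡⟨ conv-pascal M c -[1+ 0 ] refl ⟩
    conv M (suc c) -[1+ 0 ] + conv M c (+ 0)
  ≡⟨ cong₂ _+_ (conv-below-0 M (suc c)) (conv-value M c 0 ℕ.z≤n) ⟩
    multichoose (suc c) 0
  ∎
  where open ≡-Reasoning
conv-value M (suc c) (suc m) m<M = begin
    conv M (suc c) (+ suc m)
  ≡⟨ conv-pascal M c (+ m) (conv-cut-off c m M m<M) ⟩
    conv M (suc c) (+ m) + conv M c (+ suc m)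
  ≡⟨ cong₂ _+_ (conv-value M (suc c) m (ℕP.<⇒≤ m<M)) (conv-value M c (suc m) m<M) ⟩
    multichoose (suc c) m + multichoose c (suc m)
  ≡⟨ sym (multichoose-pascal c m) ⟩
    multichoose (suc c) (suc m)
  ∎
  where open ≡-Reasoning

summand : ℕ → ℕ → ℕ → ℤ
summand a b k = binomℤ (+ a - + b + + k) (+ k) * binomℤ (+ a - + b + + 1) (+ a - (+ 2 * + b) + (+ 2 * + k) + + 1)

-- Case b ≤ a, written a = b + n: the summands are those of conv b (n+1) b.
identity-when-b≤a : ∀ b n → binomℤ (+ (b ℕ.+ n)) (+ b) ≡ sumTo b (summand (b ℕ.+ n) b)
identity-when-b≤a b n = begin
    binomℤ (+ (b ℕ.+ n)) (+ b)
  ≡⟨ cong (λ a → + (a C b)) (ℕP.+-comm b n) ⟩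
    multichoose (suc n) b
  ≡⟨ sym (conv-value b (suc n) b ℕP.≤-refl) ⟩
    conv b (suc n) (+ b)
  ≡⟨ sumTo-cong b summands-agree ⟩
    sumTo b (summand (b ℕ.+ n) b)
  ∎
  where
  open ≡-Reasoning
  summands-agree : ∀ k → multichoose (suc n) k * choose (suc n) (+ b - twice k) ≡ summand (b ℕ.+ n) b k
  summands-agree k = sym (cong₂ _*_
    (cong (λ t → binomℤ t (+ k)) (top₁ (+ b) (+ n) (+ k)))
    (trans (cong₂ binomℤ (top₂ (+ b) (+ n)) (lower (+ b) (+ n) (+ k))) (choose-sym (suc n) (+ b - twice k))))
    where
    top₁ : ∀ (B N K : ℤ) → B + N - B + K ≡ N + K
    top₁ = solve-∀
    top₂ : ∀ (B N : ℤ) → B + N - B + + 1 ≡ + 1 + N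
    top₂ = solve-∀
    lower : ∀ (B N K : ℤ) → B + N - (+ 2 * B) + (+ 2 * K) + + 1 ≡ (+ 1 + N) - (B - (K + K))
    lower = solve-∀

-- Case b > a, written b = a + 1 + t: every summand vanishes, the second
-- factor when k ≤ t (negative lower index) and the first when k > t
-- (lower index above the upper one).
summand-vanishes : ∀ a t k → summand a (suc a ℕ.+ t) k ≡ + 0
summand-vanishes a t k with offset k t
... | at-or-above .k v =
  trans (cong (λ j → first * binomℤ top j) (index (+ a) (+ k) (+ v))) (ℤP.*-zeroʳ first)
  where
  b = suc a ℕ.+ (k ℕ.+ v)
  first = binomℤ (+ a - + b + + k) (+ k)
  top = + a - + b + + 1
  index : ∀ (A K V : ℤ) → A - (+ 2 * (+ 1 + A + (K + V))) + (+ 2 * K) + + 1 ≡ - (+ 1 + (A + (V + V)))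
  index = solve-∀
... | strictly-below .t u =
  trans (cong (λ i → binomℤ i (+ k) * second) (index (+ a) (+ t) (+ u)))
        (cong (_* second) (choose-above u k (ℕ.s≤s (ℕP.m≤n+m u t))))
  where
  b = suc a ℕ.+ t
  second = binomℤ (+ a - + b + + 1) (+ a - (+ 2 * + b) + (+ 2 * + k) + + 1)
  index : ∀ (A T U : ℤ) → A - (+ 1 + A + T) + (+ 1 + T + U) ≡ U
  index = solve-∀

identity-when-a<b : ∀ a t → binomℤ (+ a) (+ (suc a ℕ.+ t)) ≡ sumTo (suc a ℕ.+ t) (summand a (suc a ℕ.+ t))
identity-when-a<b a t =
  trans (choose-above a (suc a ℕ.+ t) (ℕ.s≤s (ℕP.m≤m+n a t)))
        (sym (sumTo-zero (suc a ℕ.+ t) (summand-vanishes a t)))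

mainTheorem10 : (a b : ℕ) →
    binomℤ (+ a) (+ b) ≡
      sumTo b (λ k → binomℤ (+ a - + b + + k) (+ k) * binomℤ (+ a - + b + + 1) (+ a - (+ 2 * + b) + (+ 2 * + k) + + 1))
mainTheorem10 a b with offset b a
... | at-or-above .b n    = identity-when-b≤a b n
... | strictly-below .a t = identity-when-a<b a t
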